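{- If a connected graph $G$ contains neither a diamond nor a pan as an induced subgraph, then $G$ is acyclic, or a cycle on at least $4$ vertices, or a complete graph, or a complete bipartite graph.
   Context: All graphs are finite and simple. For $k\ge3$ a $k$-pan is a $k$-cycle plus one extra vertex adjacent to exactly one cycle vertex; a pan is a $k$-pan for some $k\ge 3$. The diamond is $K_4$ minus one edge. -}

module Defs where

open import Data.Nat using (ℕ; zero; suc; _≡ᵇ_; _<ᵇ_; _∸_)
open import Data.Bool using (Bool; true; false; _∧_; _∨_; not; _xor_)
open import Data.Fin using (Fin; toℕ)
open import Data.Product using (Σ; ∃; _×_; _,_)
open import Relation.Binary.PropositionalEquality using (_≡_; _≢_)
open import Relation.Binary.Construct.Closure.ReflexiveTransitive using (Star)
open import Relation.Nullary using (¬_)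
open import Function.Definitions using (Injective; Bijective)
open import Data.Nat using (_≤_)

record Graph (n : ℕ) : Set where
  field
    adj    : Fin n → Fin n → Bool
    sym    : ∀ i j → adj i j ≡ adj j i
    irrefl : ∀ i → adj i i ≡ false
open Graph public

Adjacent : ∀ {n} → Graph n → Fin n → Fin n → Set
Adjacent G u v = adj G u v ≡ true

Connected : ∀ {n} → Graph n → Set
Connected G = ∀ u v → Star (Adjacent G) u v

-- Adjacency of the cycle C_k on vertices 0,…,k-1 (indices as naturals; used for k ≥ 3).
cycAdj : ℕ → ℕ → ℕ → Bool
cycAdj k a b = (suc a ≡ᵇ b) ∨ (suc b ≡ᵇ a)
             ∨ ((a ≡ᵇ 0) ∧ (b ≡ᵇ (k ∸ 1))) ∨ ((b ≡ᵇ 0) ∧ (a ≡ᵇ (k ∸ 1)))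

-- Adjacency of the k-pan on vertices 0,…,k: cycle 0,…,k-1, pendant vertex k adjacent to 0.
panAdj : ℕ → ℕ → ℕ → Bool
panAdj k a b = ((a <ᵇ k) ∧ (b <ᵇ k) ∧ cycAdj k a b)
             ∨ ((a ≡ᵇ k) ∧ (b ≡ᵇ 0)) ∨ ((b ≡ᵇ k) ∧ (a ≡ᵇ 0))

diamondAdj : ℕ → ℕ → Bool
diamondAdj a b = not (a ≡ᵇ b) ∧ not (((a ≡ᵇ 0) ∧ (b ≡ᵇ 3)) ∨ ((a ≡ᵇ 3) ∧ (b ≡ᵇ 0)))

HasInduced : ∀ {n} → Graph n → (m : ℕ) → (ℕ → ℕ → Bool) → Set
HasInduced {n} G m P =
  Σ (Fin m → Fin n) λ f → Injective _≡_ _≡_ f × (∀ i j → adj G (f i) (f j) ≡ P (toℕ i) (toℕ j))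

HasInducedDiamond : ∀ {n} → Graph n → Set
HasInducedDiamond G = HasInduced G 4 diamondAdj

HasInducedPan : ∀ {n} → Graph n → Set
HasInducedPan G = Σ ℕ λ k → (3 ≤ k) × HasInduced G (suc k) (panAdj k)

Acyclic : ∀ {n} → Graph n → Set
Acyclic {n} G = ¬ (Σ ℕ λ k → (3 ≤ k) × Σ (Fin k → Fin n) λ f → Injective _≡_ _≡_ f
                    × (∀ i j → cycAdj k (toℕ i) (toℕ j) ≡ true → Adjacent G (f i) (f j)))

IsLongCycle : ∀ {n} → Graph n → Set
IsLongCycle {n} G = (4 ≤ n) × Σ (Fin n → Fin n) λ f → Bijective _≡_ _≡_ f
                    × (∀ i j → adj G (f i) (f j) ≡ cycAdj n (toℕ i) (toℕ j))

IsComplete : ∀ {n} → Graph n → Set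
IsComplete G = ∀ u v → u ≢ v → Adjacent G u v

IsCompleteBipartite : ∀ {n} → Graph n → Set
IsCompleteBipartite {n} G = Σ (Fin n → Bool) λ side →
  (∃ λ u → side u ≡ true) × (∃ λ v → side v ≡ false)
  × (∀ u v → adj G u v ≡ (side u xor side v))

{-# OPTIONS --safe #-}
module Submission where

-- A vertex that sees one corner of a triangle sees all of them (seeing
-- exactly two gives a diamond, exactly one a 3-pan), and no vertex outside an induced cycle sees exactly one
-- of its vertices (that is a pan).
--
-- With a triangle, the first fact and connectivity make every two vertices adjacent. Without triangles but
-- with a 4-cycle abcd, the second fact shows that every neighbour of a sees c; connectivity then puts every
-- vertex next to a or b, and the two neighbourhoods form a complete bipartite graph.
--
-- Without triangles and 4-cycles, start from any cycle. A chord, or an outside vertex with two neighbours on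
-- it, yields a strictly shorter cycle; by well-founded induction on the length we reach an induced cycle that
-- no outside vertex touches, which by connectivity spans G, so G is that cycle. Such a G therefore has a
-- cycle exactly when every vertex has degree at least 2: then a maximal path closes up into one.

open import Defs hiding (sym)
open import Data.Bool using (true; false; _∧_; _∨_; _xor_; T)
open import Data.Bool.Properties using (T-≡; T-∨; T-∧; ∨-identityʳ)
open import Data.Nat using (ℕ; zero; suc; pred; _+_; _∸_; _≤_; _<_; z≤n; s≤s; _≡ᵇ_; _<ᵇ_; _<?_; NonZero)
open import Data.Nat.Properties
open import Data.Nat.Induction using (<-rec)
open import Data.Nat.DivMod using (_mod_; m%n<n; m<n⇒m%n≡m)
open import Data.Fin using (Fin; toℕ; fromℕ<) renaming (zero to fzero; suc to fsuc)
import Data.Fin.Properties as Fin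
open import Data.Product using (∃; ∃₂; _×_; _,_; proj₁; proj₂)
open import Data.Sum using (_⊎_; inj₁; inj₂; map₂)
open import Data.Empty using (⊥-elim)
open import Function.Base using (_∘_)
open import Function.Bundles using (Equivalence)
open import Function.Definitions using (Injective; Surjective)
open import Relation.Nullary using (¬_; Dec; yes; no; ¬?)
open import Relation.Nullary.Decidable using (_×-dec_)
open import Relation.Binary.Definitions using (tri<; tri≈; tri>)
open import Relation.Binary.PropositionalEquality
open import Relation.Binary.Construct.Closure.ReflexiveTransitive using (Star; ε; _◅_)

open Equivalence using (to; from)

true≢false : true ≢ false
true≢false ()

≡true⇒T : ∀ {x} → x ≡ true → T x
≡true⇒T = from T-≡

T⇒≡true : ∀ {x} → T x → x ≡ true
T⇒≡true = to T-≡

≡ᵇ-refl : ∀ m → (m ≡ᵇ m) ≡ true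
≡ᵇ-refl m = T⇒≡true (≡⇒≡ᵇ m m refl)

≢⇒≡ᵇ≡false : ∀ {m n} → m ≢ n → (m ≡ᵇ n) ≡ false
≢⇒≡ᵇ≡false {m} {n} m≢n with m ≡ᵇ n in eq
... | true  = ⊥-elim (m≢n (≡ᵇ⇒≡ m n (≡true⇒T eq)))
... | false = refl

<⇒<ᵇ≡true : ∀ {m n} → m < n → (m <ᵇ n) ≡ true
<⇒<ᵇ≡true m<n = T⇒≡true (<⇒<ᵇ m<n)

<ᵇ-irrefl : ∀ m → (m <ᵇ m) ≡ false
<ᵇ-irrefl m with m <ᵇ m in eq
... | true  = ⊥-elim (n≮n m (<ᵇ⇒< m m (≡true⇒T eq)))
... | false = refl

∨-introˡ : ∀ {x} y → x ≡ true → x ∨ y ≡ true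
∨-introˡ _ refl = refl

∨-introʳ : ∀ x {y} → y ≡ true → x ∨ y ≡ true
∨-introʳ true  _ = refl
∨-introʳ false y = y

data CycleEdge (k : ℕ) : ℕ → ℕ → Set where
  next  : ∀ a → CycleEdge k a (suc a)
  prev  : ∀ a → CycleEdge k (suc a) a
  wrap  : CycleEdge k 0 (k ∸ 1)
  wrap⁻ : CycleEdge k (k ∸ 1) 0

CycleEdge-sym : ∀ {k a b} → CycleEdge k a b → CycleEdge k b a
CycleEdge-sym (next a) = prev a
CycleEdge-sym (prev a) = next a
CycleEdge-sym wrap     = wrap⁻
CycleEdge-sym wrap⁻    = wrap

cycAdj⇒CycleEdge : ∀ k a b → cycAdj k a b ≡ true → CycleEdge k a b
cycAdj⇒CycleEdge k a b adj with to T-∨ (≡true⇒T adj)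
... | inj₁ a+1≡b = subst (CycleEdge k a) (≡ᵇ⇒≡ _ _ a+1≡b) (next a)
... | inj₂ rest with to T-∨ rest
... | inj₁ b+1≡a = subst (λ c → CycleEdge k c b) (≡ᵇ⇒≡ _ _ b+1≡a) (prev b)
... | inj₂ rest′ with to T-∨ rest′
... | inj₁ wrapped =
  let a≡0 , b≡k-1 = to T-∧ wrapped in
  subst₂ (CycleEdge k) (sym (≡ᵇ⇒≡ _ _ a≡0)) (sym (≡ᵇ⇒≡ _ _ b≡k-1)) wrap
... | inj₂ wrapped =
  let b≡0 , a≡k-1 = to T-∧ wrapped in
  subst₂ (CycleEdge k) (sym (≡ᵇ⇒≡ _ _ a≡k-1)) (sym (≡ᵇ⇒≡ _ _ b≡0)) wrap⁻

CycleEdge⇒cycAdj : ∀ {k a b} → CycleEdge k a b → cycAdj k a b ≡ true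
CycleEdge⇒cycAdj (next a) = ∨-introˡ _ (≡ᵇ-refl a)
CycleEdge⇒cycAdj (prev a) = ∨-introʳ (suc (suc a) ≡ᵇ a) (∨-introˡ _ (≡ᵇ-refl a))
CycleEdge⇒cycAdj {k} wrap =
  ∨-introʳ (1 ≡ᵇ k ∸ 1) (∨-introˡ _ (≡ᵇ-refl (k ∸ 1)))
CycleEdge⇒cycAdj {k} wrap⁻ =
  ∨-introʳ false (∨-introʳ (1 ≡ᵇ k ∸ 1) (∨-introʳ ((k ∸ 1 ≡ᵇ 0) ∧ (0 ≡ᵇ k ∸ 1)) (≡ᵇ-refl (k ∸ 1))))

panAdj-cycle : ∀ {k a b} → a < k → b < k → panAdj k a b ≡ cycAdj k a b
panAdj-cycle a<k b<k
  rewrite <⇒<ᵇ≡true a<k | <⇒<ᵇ≡true b<k | ≢⇒≡ᵇ≡false (<⇒≢ a<k) | ≢⇒≡ᵇ≡false (<⇒≢ b<k)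
  = ∨-identityʳ _

panAdj-handleʳ : ∀ {k a} → a < k → panAdj k a k ≡ (a ≡ᵇ 0)
panAdj-handleʳ {k} a<k
  rewrite <⇒<ᵇ≡true a<k | <ᵇ-irrefl k | ≢⇒≡ᵇ≡false (<⇒≢ a<k) | ≡ᵇ-refl k = refl

panAdj-handleˡ : ∀ {k b} → b < k → panAdj k k b ≡ (b ≡ᵇ 0)
panAdj-handleˡ {k} b<k
  rewrite <ᵇ-irrefl k | ≢⇒≡ᵇ≡false (<⇒≢ b<k) | ≡ᵇ-refl k = ∨-identityʳ _

panAdj-handle-handle : ∀ {k} → 0 < k → panAdj k k k ≡ false
panAdj-handle-handle {suc k} _ rewrite <ᵇ-irrefl (suc k) | ≡ᵇ-refl k = refl

-- Opaque, so that snoc m h v t stays rigid and unification can recover m, h and v from it.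
opaque
  snoc : {A : Set} → ℕ → (ℕ → A) → A → ℕ → A
  snoc m h v t with t <? m
  ... | yes _ = h t
  ... | no  _ = v

opaque
  unfolding snoc

  snoc-< : ∀ {A : Set} {m h} {v : A} {t} → t < m → snoc m h v t ≡ h t
  snoc-< {m = m} {t = t} t<m with t <? m
  ... | yes _   = refl
  ... | no  t≮m = ⊥-elim (t≮m t<m)

  snoc-last : ∀ {A : Set} {m h} {v : A} → snoc m h v m ≡ v
  snoc-last {m = m} with m <? m
  ... | yes m<m = ⊥-elim (n≮n m m<m)
  ... | no  _   = refl

  snoc-cases : ∀ {A : Set} {m h} {v : A} {t} → t < suc m
             → (t < m × snoc m h v t ≡ h t) ⊎ (t ≡ m × snoc m h v t ≡ v)
  snoc-cases {m = m} {t = t} t≤m with t <? m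
  ... | yes t<m = inj₁ (t<m , refl)
  ... | no  t≮m = inj₂ (≤-antisym (≤-pred t≤m) (≮⇒≥ t≮m) , refl)

Star-closed : ∀ {A : Set} {R : A → A → Set} (P : A → Set) → (∀ {x y} → P x → R x y → P y)
            → ∀ {s t} → Star R s t → P s → P t
Star-closed P step ε        ps = ps
Star-closed P step (r ◅ rs) ps = Star-closed P step rs (step ps r)

Star-exit : ∀ {A : Set} {R : A → A → Set} {P : A → Set} → (∀ x → Dec (P x))
          → ∀ {s t} → Star R s t → P s → ¬ P t → ∃₂ λ x y → P x × ¬ P y × R x y
Star-exit P? ε        ps ¬pt = ⊥-elim (¬pt ps)
Star-exit P? (_◅_ {j = y} r rs) ps ¬pt with P? y
... | yes py = Star-exit P? rs py ¬pt
... | no ¬py = _ , y , ps , ¬py , r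

chord-gap : ∀ {k} a d → a < a + d → ¬ CycleEdge k a (a + d) → 2 ≤ d
chord-gap a zero          a<a+0 _  = ⊥-elim (<-irrefl (sym (+-identityʳ a)) a<a+0)
chord-gap a (suc zero)    _     ¬e = ⊥-elim (¬e (subst (CycleEdge _ a) (+-comm 1 a) (next a)))
chord-gap a (suc (suc d)) _     _  = s≤s (s≤s z≤n)

chord-length : ∀ {k} a d → a + d < k → ¬ CycleEdge k a (a + d) → suc d < k
chord-length {suc k} zero    d d<k+1 ¬e = s≤s (≤∧≢⇒< (≤-pred d<k+1) λ { refl → ¬e wrap })
chord-length         (suc a) d a+d<k _  = ≤-trans (s≤s (s≤s (m≤n+m d a))) a+d<k

last-index : ∀ {a k} → a < k → ¬ suc a < k → a ≡ k ∸ 1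
last-index a<k a+1≮k = cong (_∸ 1) (≤-antisym a<k (≮⇒≥ a+1≮k))

k∸1<k : ∀ {k} → 0 < k → k ∸ 1 < k
k∸1<k {suc k} _ = ≤-refl

back-edge-gap : ∀ c d → c + d ≢ c → c ≢ c + d ∸ 1 → 2 ≤ d
back-edge-gap c zero          c+0≢c _       = ⊥-elim (c+0≢c (+-identityʳ c))
back-edge-gap c (suc zero)    _     c≢c+1-1 = ⊥-elim (c≢c+1-1 (sym (m+n∸n≡m c 1)))
back-edge-gap c (suc (suc d)) _     _       = s≤s (s≤s z≤n)

toℕ-mod : ∀ {a k} .{{_ : NonZero k}} → a < k → toℕ (a mod k) ≡ a
toℕ-mod {a} {k} a<k = trans (Fin.toℕ-fromℕ< (m%n<n a k)) (m<n⇒m%n≡m a<k)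

module _ {n : ℕ} (G : Graph n) where

  Adj : Fin n → Fin n → Set
  Adj = Adjacent G

  Adj-sym : ∀ {u v} → Adj u v → Adj v u
  Adj-sym {u} {v} uv = trans (Graph.sym G v u) uv

  Adj-irrefl : ∀ {u} → ¬ Adj u u
  Adj-irrefl {u} uu = true≢false (trans (sym uu) (irrefl G u))

  Adj⇒≢ : ∀ {u v} → Adj u v → u ≢ v
  Adj⇒≢ uv refl = Adj-irrefl uv

  ¬Adj⇒adj≡false : ∀ {u v} → ¬ Adj u v → adj G u v ≡ false
  ¬Adj⇒adj≡false {u} {v} ¬uv with adj G u v
  ... | true  = ⊥-elim (¬uv refl)
  ... | false = refl

  Adj? : ∀ u v → Dec (Adj u v)
  Adj? u v with adj G u v
  ... | true  = yes refl
  ... | false = no λ ()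

  Triangle : Fin n → Fin n → Fin n → Set
  Triangle x y z = Adj x y × Adj y z × Adj x z

  Square : Fin n → Fin n → Fin n → Fin n → Set
  Square a b c d = Adj a b × Adj b c × Adj c d × Adj d a × a ≢ c × b ≢ d

  induced-diamond : ∀ {p q r s} → Adj p q → Adj p r → Adj q r → Adj q s → Adj r s → ¬ Adj p s → p ≢ s
                  → HasInducedDiamond G
  induced-diamond {p} {q} {r} {s} pq pr qr qs rs ¬ps p≢s = f , f-injective , f-adj
    where
      f : Fin 4 → Fin n
      f fzero                      = p
      f (fsuc fzero)               = q
      f (fsuc (fsuc fzero))        = r
      f (fsuc (fsuc (fsuc fzero))) = s
      f-injective : Injective _≡_ _≡_ f
      f-injective {fzero}                      {fzero}                      _  = refl
      f-injective {fzero}                      {fsuc fzero}                 eq = ⊥-elim (Adj⇒≢ pq eq)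
      f-injective {fzero}                      {fsuc (fsuc fzero)}          eq = ⊥-elim (Adj⇒≢ pr eq)
      f-injective {fzero}                      {fsuc (fsuc (fsuc fzero))}   eq = ⊥-elim (p≢s eq)
      f-injective {fsuc fzero}                 {fzero}                      eq = ⊥-elim (Adj⇒≢ pq (sym eq))
      f-injective {fsuc fzero}                 {fsuc fzero}                 _  = refl
      f-injective {fsuc fzero}                 {fsuc (fsuc fzero)}          eq = ⊥-elim (Adj⇒≢ qr eq)
      f-injective {fsuc fzero}                 {fsuc (fsuc (fsuc fzero))}   eq = ⊥-elim (Adj⇒≢ qs eq)
      f-injective {fsuc (fsuc fzero)}          {fzero}                      eq = ⊥-elim (Adj⇒≢ pr (sym eq))
      f-injective {fsuc (fsuc fzero)}          {fsuc fzero}                 eq = ⊥-elim (Adj⇒≢ qr (sym eq))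
      f-injective {fsuc (fsuc fzero)}          {fsuc (fsuc fzero)}          _  = refl
      f-injective {fsuc (fsuc fzero)}          {fsuc (fsuc (fsuc fzero))}   eq = ⊥-elim (Adj⇒≢ rs eq)
      f-injective {fsuc (fsuc (fsuc fzero))}   {fzero}                      eq = ⊥-elim (p≢s (sym eq))
      f-injective {fsuc (fsuc (fsuc fzero))}   {fsuc fzero}                 eq = ⊥-elim (Adj⇒≢ qs (sym eq))
      f-injective {fsuc (fsuc (fsuc fzero))}   {fsuc (fsuc fzero)}          eq = ⊥-elim (Adj⇒≢ rs (sym eq))
      f-injective {fsuc (fsuc (fsuc fzero))}   {fsuc (fsuc (fsuc fzero))}   _  = refl
      f-adj : ∀ i j → adj G (f i) (f j) ≡ diamondAdj (toℕ i) (toℕ j)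
      f-adj fzero                      fzero                      = irrefl G p
      f-adj fzero                      (fsuc fzero)               = pq
      f-adj fzero                      (fsuc (fsuc fzero))        = pr
      f-adj fzero                      (fsuc (fsuc (fsuc fzero))) = ¬Adj⇒adj≡false ¬ps
      f-adj (fsuc fzero)               fzero                      = Adj-sym pq
      f-adj (fsuc fzero)               (fsuc fzero)               = irrefl G q
      f-adj (fsuc fzero)               (fsuc (fsuc fzero))        = qr
      f-adj (fsuc fzero)               (fsuc (fsuc (fsuc fzero))) = qs
      f-adj (fsuc (fsuc fzero))        fzero                      = Adj-sym pr
      f-adj (fsuc (fsuc fzero))        (fsuc fzero)               = Adj-sym qr
      f-adj (fsuc (fsuc fzero))        (fsuc (fsuc fzero))        = irrefl G r
      f-adj (fsuc (fsuc fzero))        (fsuc (fsuc (fsuc fzero))) = rs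
      f-adj (fsuc (fsuc (fsuc fzero))) fzero                      = ¬Adj⇒adj≡false (¬ps ∘ Adj-sym)
      f-adj (fsuc (fsuc (fsuc fzero))) (fsuc fzero)               = Adj-sym qs
      f-adj (fsuc (fsuc (fsuc fzero))) (fsuc (fsuc fzero))        = Adj-sym rs
      f-adj (fsuc (fsuc (fsuc fzero))) (fsuc (fsuc (fsuc fzero))) = irrefl G s

  induced-pan : ∀ k → 3 ≤ k → (h : ℕ → Fin n)
              → (∀ a b → a < k → b < k → h a ≡ h b → a ≡ b)
              → (∀ a b → a < k → b < k → adj G (h a) (h b) ≡ cycAdj k a b)
              → (v : Fin n) → (∀ a → a < k → h a ≢ v) → Adj v (h 0)
              → (∀ a → 0 < a → a < k → ¬ Adj v (h a))
              → HasInducedPan G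
  induced-pan k 3≤k h h-distinct h-adj v v-new v-h0 v-only-h0 =
    k , 3≤k , f , f-injective , λ i j → f-adj (Fin.toℕ<n i) (Fin.toℕ<n j)
    where
      f : Fin (suc k) → Fin n
      f i = snoc k h v (toℕ i)
      f-injective : Injective _≡_ _≡_ f
      f-injective {i} {j} eq with snoc-cases (Fin.toℕ<n i) | snoc-cases (Fin.toℕ<n j)
      ... | inj₁ (i<k , fi) | inj₁ (j<k , fj) =
            Fin.toℕ-injective (h-distinct _ _ i<k j<k (trans (sym fi) (trans eq fj)))
      ... | inj₁ (i<k , fi) | inj₂ (_ , fj) = ⊥-elim (v-new _ i<k (trans (sym fi) (trans eq fj)))
      ... | inj₂ (_ , fi) | inj₁ (j<k , fj) = ⊥-elim (v-new _ j<k (trans (sym fj) (trans (sym eq) fi)))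
      ... | inj₂ (i≡k , _) | inj₂ (j≡k , _) = Fin.toℕ-injective (trans i≡k (sym j≡k))
      h-v : ∀ a → a < k → adj G (h a) v ≡ (a ≡ᵇ 0)
      h-v zero    _   = Adj-sym v-h0
      h-v (suc a) a<k = ¬Adj⇒adj≡false (v-only-h0 (suc a) (s≤s z≤n) a<k ∘ Adj-sym)
      f-adj : ∀ {a b} → a < suc k → b < suc k → adj G (snoc k h v a) (snoc k h v b) ≡ panAdj k a b
      f-adj a≤k b≤k with snoc-cases a≤k | snoc-cases b≤k
      ... | inj₁ (a<k , fa) | inj₁ (b<k , fb) =
            trans (cong₂ (adj G) fa fb) (trans (h-adj _ _ a<k b<k) (sym (panAdj-cycle a<k b<k)))
      ... | inj₁ (a<k , fa) | inj₂ (refl , fb) =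
            trans (cong₂ (adj G) fa fb) (trans (h-v _ a<k) (sym (panAdj-handleʳ a<k)))
      ... | inj₂ (refl , fa) | inj₁ (b<k , fb) =
            trans (cong₂ (adj G) fa fb) (trans (Graph.sym G v _) (trans (h-v _ b<k) (sym (panAdj-handleˡ b<k))))
      ... | inj₂ (refl , fa) | inj₂ (refl , fb) =
            trans (cong₂ (adj G) fa fb) (trans (irrefl G v) (sym (panAdj-handle-handle (≤-trans (s≤s z≤n) 3≤k))))

  triangle-pan : ∀ {x y z v} → Triangle x y z → Adj v x → ¬ Adj v y → ¬ Adj v z → HasInducedPan G
  triangle-pan {x} {y} {z} {v} (xy , yz , xz) vx ¬vy ¬vz =
    induced-pan 3 ≤-refl h h-distinct h-adj v v-new vx v-only-x
    where
      h : ℕ → Fin n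
      h 0 = x
      h 1 = y
      h _ = z
      h-distinct : ∀ a b → a < 3 → b < 3 → h a ≡ h b → a ≡ b
      h-distinct 0 0 _ _ _  = refl
      h-distinct 0 1 _ _ eq = ⊥-elim (Adj⇒≢ xy eq)
      h-distinct 0 2 _ _ eq = ⊥-elim (Adj⇒≢ xz eq)
      h-distinct 1 0 _ _ eq = ⊥-elim (Adj⇒≢ xy (sym eq))
      h-distinct 1 1 _ _ _  = refl
      h-distinct 1 2 _ _ eq = ⊥-elim (Adj⇒≢ yz eq)
      h-distinct 2 0 _ _ eq = ⊥-elim (Adj⇒≢ xz (sym eq))
      h-distinct 2 1 _ _ eq = ⊥-elim (Adj⇒≢ yz (sym eq))
      h-distinct 2 2 _ _ _  = refl
      h-distinct (suc (suc (suc _))) _ (s≤s (s≤s (s≤s ()))) _ _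
      h-distinct _ (suc (suc (suc _))) _ (s≤s (s≤s (s≤s ()))) _
      h-adj : ∀ a b → a < 3 → b < 3 → adj G (h a) (h b) ≡ cycAdj 3 a b
      h-adj 0 0 _ _ = irrefl G x
      h-adj 0 1 _ _ = xy
      h-adj 0 2 _ _ = xz
      h-adj 1 0 _ _ = Adj-sym xy
      h-adj 1 1 _ _ = irrefl G y
      h-adj 1 2 _ _ = yz
      h-adj 2 0 _ _ = Adj-sym xz
      h-adj 2 1 _ _ = Adj-sym yz
      h-adj 2 2 _ _ = irrefl G z
      h-adj (suc (suc (suc _))) _ (s≤s (s≤s (s≤s ()))) _
      h-adj _ (suc (suc (suc _))) _ (s≤s (s≤s (s≤s ())))
      v-new : ∀ a → a < 3 → h a ≢ v
      v-new 0 _ refl = Adj-irrefl vx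
      v-new 1 _ refl = ¬vz yz
      v-new 2 _ refl = ¬vy (Adj-sym yz)
      v-new (suc (suc (suc _))) (s≤s (s≤s (s≤s ())))
      v-only-x : ∀ a → 0 < a → a < 3 → ¬ Adj v (h a)
      v-only-x 1 _ _ = ¬vy
      v-only-x 2 _ _ = ¬vz
      v-only-x (suc (suc (suc _))) _ (s≤s (s≤s (s≤s ())))

  square-pan : ∀ {x y z w v} → Square x y z w → ¬ Adj x z → ¬ Adj y w
             → Adj v x → ¬ Adj v y → ¬ Adj v z → ¬ Adj v w → v ≢ y → v ≢ z → v ≢ w → HasInducedPan G
  square-pan {x} {y} {z} {w} {v} (xy , yz , zw , wx , x≢z , y≢w) ¬xz ¬yw vx ¬vy ¬vz ¬vw v≢y v≢z v≢w =
    induced-pan 4 (n≤1+n 3) h h-distinct h-adj v v-new vx v-only-x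
    where
      h : ℕ → Fin n
      h 0 = x
      h 1 = y
      h 2 = z
      h _ = w
      h-distinct : ∀ a b → a < 4 → b < 4 → h a ≡ h b → a ≡ b
      h-distinct 0 0 _ _ _  = refl
      h-distinct 0 1 _ _ eq = ⊥-elim (Adj⇒≢ xy eq)
      h-distinct 0 2 _ _ eq = ⊥-elim (x≢z eq)
      h-distinct 0 3 _ _ eq = ⊥-elim (Adj⇒≢ wx (sym eq))
      h-distinct 1 0 _ _ eq = ⊥-elim (Adj⇒≢ xy (sym eq))
      h-distinct 1 1 _ _ _  = refl
      h-distinct 1 2 _ _ eq = ⊥-elim (Adj⇒≢ yz eq)
      h-distinct 1 3 _ _ eq = ⊥-elim (y≢w eq)
      h-distinct 2 0 _ _ eq = ⊥-elim (x≢z (sym eq))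
      h-distinct 2 1 _ _ eq = ⊥-elim (Adj⇒≢ yz (sym eq))
      h-distinct 2 2 _ _ _  = refl
      h-distinct 2 3 _ _ eq = ⊥-elim (Adj⇒≢ zw eq)
      h-distinct 3 0 _ _ eq = ⊥-elim (Adj⇒≢ wx eq)
      h-distinct 3 1 _ _ eq = ⊥-elim (y≢w (sym eq))
      h-distinct 3 2 _ _ eq = ⊥-elim (Adj⇒≢ zw (sym eq))
      h-distinct 3 3 _ _ _  = refl
      h-distinct (suc (suc (suc (suc _)))) _ (s≤s (s≤s (s≤s (s≤s ())))) _ _
      h-distinct _ (suc (suc (suc (suc _)))) _ (s≤s (s≤s (s≤s (s≤s ())))) _
      h-adj : ∀ a b → a < 4 → b < 4 → adj G (h a) (h b) ≡ cycAdj 4 a b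
      h-adj 0 0 _ _ = irrefl G x
      h-adj 0 1 _ _ = xy
      h-adj 0 2 _ _ = ¬Adj⇒adj≡false ¬xz
      h-adj 0 3 _ _ = Adj-sym wx
      h-adj 1 0 _ _ = Adj-sym xy
      h-adj 1 1 _ _ = irrefl G y
      h-adj 1 2 _ _ = yz
      h-adj 1 3 _ _ = ¬Adj⇒adj≡false ¬yw
      h-adj 2 0 _ _ = ¬Adj⇒adj≡false (¬xz ∘ Adj-sym)
      h-adj 2 1 _ _ = Adj-sym yz
      h-adj 2 2 _ _ = irrefl G z
      h-adj 2 3 _ _ = zw
      h-adj 3 0 _ _ = wx
      h-adj 3 1 _ _ = ¬Adj⇒adj≡false (¬yw ∘ Adj-sym)
      h-adj 3 2 _ _ = Adj-sym zw
      h-adj 3 3 _ _ = irrefl G w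
      h-adj (suc (suc (suc (suc _)))) _ (s≤s (s≤s (s≤s (s≤s ())))) _
      h-adj _ (suc (suc (suc (suc _)))) _ (s≤s (s≤s (s≤s (s≤s ()))))
      v-new : ∀ a → a < 4 → h a ≢ v
      v-new 0 _ refl = Adj-irrefl vx
      v-new 1 _ refl = v≢y refl
      v-new 2 _ refl = v≢z refl
      v-new 3 _ refl = v≢w refl
      v-new (suc (suc (suc (suc _)))) (s≤s (s≤s (s≤s (s≤s ()))))
      v-only-x : ∀ a → 0 < a → a < 4 → ¬ Adj v (h a)
      v-only-x 1 _ _ = ¬vy
      v-only-x 2 _ _ = ¬vz
      v-only-x 3 _ _ = ¬vw
      v-only-x (suc (suc (suc (suc _)))) _ (s≤s (s≤s (s≤s (s≤s ()))))

  -- Graphs with a triangle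
  module _ (diamond-free : ¬ HasInducedDiamond G) (pan-free : ¬ HasInducedPan G) where

    triangle-neighbour : ∀ {x y z v} → Triangle x y z → Adj v x → v ≢ y → v ≢ z → Adj v y
    triangle-neighbour {x} {y} {z} {v} t@(xy , yz , xz) vx v≢y v≢z with Adj? v y | Adj? v z
    ... | yes vy | _      = vy
    ... | no ¬vy | yes vz = ⊥-elim (diamond-free (induced-diamond vx vz xz xy (Adj-sym yz) ¬vy v≢y))
    ... | no ¬vy | no ¬vz = ⊥-elim (pan-free (triangle-pan t vx ¬vy ¬vz))

    edge-in-triangle : ∀ {a b c x} → Triangle a b c → Adj x a → ∃ λ z → Triangle x a z
    edge-in-triangle {a} {b} {c} {x} t@(ab , bc , ac) xa with x Fin.≟ b | x Fin.≟ c
    ... | yes refl | _        = c , Adj-sym ab , ac , bc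
    ... | no _     | yes refl = b , Adj-sym ac , ab , Adj-sym bc
    ... | no x≢b   | no x≢c   = b , xa , ab , triangle-neighbour t xa x≢b x≢c

    triangle-corner-neighbours : ∀ {x y z u w} → Triangle x y z → Adj u x → Adj w x → u ≢ w → Adj u w
    triangle-corner-neighbours {w = w} t ux wx u≢w with edge-in-triangle t ux
    ... | z , (_ , xz , uz) with w Fin.≟ z
    ... | yes refl = uz
    ... | no w≢z   = Adj-sym (triangle-neighbour (Adj-sym ux , uz , xz) wx (u≢w ∘ sym) w≢z)

    triangle-corner-dominates : Connected G → ∀ {a b c} → Triangle a b c → ∀ v → v ≡ a ⊎ Adj v a
    triangle-corner-dominates connected {a} t v = Star-closed NearA step (connected a v) (inj₁ refl)
      where
      NearA : Fin n → Set
      NearA v = v ≡ a ⊎ Adj v a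
      step : ∀ {x y} → NearA x → Adj x y → NearA y
      step (inj₁ refl) xy = inj₂ (Adj-sym xy)
      step {x} {y} (inj₂ xa) xy with y Fin.≟ a
      ... | yes y≡a = inj₁ y≡a
      ... | no y≢a  = let _ , t′ = edge-in-triangle t xa in
                      inj₂ (triangle-corner-neighbours t′ (Adj-sym xy) (Adj-sym xa) y≢a)

    triangle⇒complete : Connected G → ∀ {a b c} → Triangle a b c → IsComplete G
    triangle⇒complete connected t u v u≢v
      with triangle-corner-dominates connected t u | triangle-corner-dominates connected t v
    ... | inj₁ refl | inj₁ refl = ⊥-elim (u≢v refl)
    ... | inj₁ refl | inj₂ va   = Adj-sym va
    ... | inj₂ ua   | inj₁ refl = ua
    ... | inj₂ ua   | inj₂ va   = triangle-corner-neighbours t ua va u≢v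

  -- Triangle-free graphs with a 4-cycle
  module _ (pan-free : ¬ HasInducedPan G) (triangle-free : ∀ {a b c} → ¬ Triangle a b c) where

    square-rotate : ∀ {a b c d} → Square a b c d → Square b c d a
    square-rotate (ab , bc , cd , da , a≢c , b≢d) = bc , cd , da , ab , b≢d , a≢c ∘ sym

    square-reflect : ∀ {a b c d} → Square a b c d → Square b a d c
    square-reflect (ab , bc , cd , da , a≢c , b≢d) =
      Adj-sym ab , Adj-sym da , Adj-sym cd , Adj-sym bc , b≢d , a≢c

    square-opposite : ∀ {x y z w v} → Square x y z w → Adj v x → Adj v z
    square-opposite {x} {y} {z} {w} {v} sq@(xy , yz , zw , wx , _) vx
      with v Fin.≟ y | v Fin.≟ w | v Fin.≟ z
    ... | yes refl | _        | _        = yz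
    ... | no _     | yes refl | _        = Adj-sym zw
    ... | no _     | no _     | yes refl = ⊥-elim (triangle-free (xy , yz , Adj-sym vx))
    ... | no v≢y   | no v≢w   | no v≢z   with Adj? v z
    ...   | yes vz = vz
    ...   | no ¬vz = ⊥-elim (pan-free (square-pan sq ¬xz ¬yw vx ¬vy ¬vz ¬vw v≢y v≢z v≢w))
      where
      ¬xz = λ xz → triangle-free (xy , yz , xz)
      ¬yw = λ yw → triangle-free (yz , zw , yw)
      ¬vy = λ vy → triangle-free (vx , xy , vy)
      ¬vw = λ vw → triangle-free (vx , Adj-sym wx , vw)

    square-attach : ∀ {a b c d x} → Square a b c d → Adj x a → x ≢ b → Square x a b c
    square-attach sq@(ab , bc , _ , _ , a≢c , _) xa x≢b =
      xa , ab , bc , Adj-sym (square-opposite sq xa) , x≢b , a≢c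

    square-second-neighbour : ∀ {a b c d x y} → Square a b c d → Adj x a → Adj y x → Adj y b
    square-second-neighbour {b = b} {x = x} sq xa yx with x Fin.≟ b
    ... | yes refl = yx
    ... | no x≢b   = square-opposite (square-attach sq xa x≢b) yx

    square-cross : ∀ {a b c d u v} → Square a b c d → Adj u a → Adj v b → Adj u v
    square-cross {b = b} {u = u} sq ua vb with u Fin.≟ b
    ... | yes refl = Adj-sym vb
    ... | no u≢b   = Adj-sym (square-opposite (square-rotate (square-rotate (square-attach sq ua u≢b))) vb)

    square-corners-dominate : Connected G → ∀ {a b c d} → Square a b c d → ∀ v → Adj v a ⊎ Adj v b
    square-corners-dominate connected {a} {b} sq@(ab , _) v = Star-closed Near step (connected a v) (inj₂ ab)
      where
      Near : Fin n → Set
      Near v = Adj v a ⊎ Adj v b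
      step : ∀ {x y} → Near x → Adj x y → Near y
      step (inj₁ xa) xy = inj₂ (square-second-neighbour sq xa (Adj-sym xy))
      step (inj₂ xb) xy = inj₁ (square-second-neighbour (square-reflect sq) xb (Adj-sym xy))

    square⇒complete-bipartite : Connected G → ∀ {a b c d} → Square a b c d → IsCompleteBipartite G
    square⇒complete-bipartite connected {a} {b} sq@(ab , _) =
      (λ u → adj G u a) , (b , Adj-sym ab) , (a , irrefl G a) , bipartite
      where
      on-b : ∀ {v} → ¬ Adj v a → Adj v b
      on-b {v} ¬va with square-corners-dominate connected sq v
      ... | inj₁ va = ⊥-elim (¬va va)
      ... | inj₂ vb = vb
      bipartite : ∀ u v → adj G u v ≡ (adj G u a xor adj G v a)
      bipartite u v with Adj? u a | Adj? v a
      ... | yes ua | yes va rewrite ua | va = ¬Adj⇒adj≡false λ uv → triangle-free (uv , va , ua)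
      ... | yes ua | no ¬va rewrite ua | ¬Adj⇒adj≡false ¬va = square-cross sq ua (on-b ¬va)
      ... | no ¬ua | yes va rewrite va | ¬Adj⇒adj≡false ¬ua = Adj-sym (square-cross sq va (on-b ¬ua))
      ... | no ¬ua | no ¬va rewrite ¬Adj⇒adj≡false ¬ua | ¬Adj⇒adj≡false ¬va =
            ¬Adj⇒adj≡false λ uv → triangle-free (uv , on-b ¬va , on-b ¬ua)

  -- Paths and cycles

  -- m counts vertices: the path is p 0, …, p (m ∸ 1).
  record Path (m : ℕ) (p : ℕ → Fin n) : Set where
    field
      distinct : ∀ a b → a < m → b < m → p a ≡ p b → a ≡ b
      step     : ∀ a → suc a < m → Adj (p a) (p (suc a))

  record Cycle (k : ℕ) (g : ℕ → Fin n) : Set where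
    field
      path     : Path k g
      3≤length : 3 ≤ k
      closing  : Adj (g 0) (g (k ∸ 1))
    open Path path public

  Occurs : ℕ → (ℕ → Fin n) → Fin n → Set
  Occurs m p v = ∃ λ a → a < m × p a ≡ v

  Occurs? : ∀ m p v → Dec (Occurs m p v)
  Occurs? m p v = anyUpTo? (λ a → p a Fin.≟ v) m

  Path-take : ∀ {m p j} → Path m p → j ≤ m → Path j p
  Path-take P j≤m = record
    { distinct = λ a b a<j b<j → distinct a b (≤-trans a<j j≤m) (≤-trans b<j j≤m)
    ; step     = λ a a+1<j → step a (≤-trans a+1<j j≤m)
    }
    where open Path P

  Path-drop : ∀ {m p} a → Path (a + m) p → Path m (λ t → p (a + t))
  Path-drop {m} {p} a P = record
    { distinct = λ t s t<m s<m eq → +-cancelˡ-≡ a _ _ (distinct _ _ (+-monoʳ-< a t<m) (+-monoʳ-< a s<m) eq)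
    ; step     = λ t t+1<m → subst (λ i → Adj (p (a + t)) (p i)) (sym (+-suc a t))
                               (step (a + t) (subst (_< a + m) (+-suc a t) (+-monoʳ-< a t+1<m)))
    }
    where open Path P

  Path-snoc : ∀ {m p v} → Path (suc m) p → Adj (p m) v → ¬ Occurs (suc m) p v
            → Path (suc (suc m)) (snoc (suc m) p v)
  Path-snoc {m} {p} {v} P pm-v v-new = record { distinct = distinct′ ; step = step′ }
    where
    open Path P
    distinct′ : ∀ a b → a < suc (suc m) → b < suc (suc m) → snoc (suc m) p v a ≡ snoc (suc m) p v b → a ≡ b
    distinct′ a b a≤m+1 b≤m+1 eq with snoc-cases a≤m+1 | snoc-cases b≤m+1
    ... | inj₁ (a≤m , pa) | inj₁ (b≤m , pb) = distinct a b a≤m b≤m (trans (sym pa) (trans eq pb))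
    ... | inj₁ (a≤m , pa) | inj₂ (_ , pb)   = ⊥-elim (v-new (a , a≤m , trans (sym pa) (trans eq pb)))
    ... | inj₂ (_ , pa)   | inj₁ (b≤m , pb) = ⊥-elim (v-new (b , b≤m , trans (sym pb) (trans (sym eq) pa)))
    ... | inj₂ (a≡ , _)   | inj₂ (b≡ , _)   = trans a≡ (sym b≡)
    step′ : ∀ a → suc a < suc (suc m) → Adj (snoc (suc m) p v a) (snoc (suc m) p v (suc a))
    step′ a a+1≤m+1 with snoc-cases a+1≤m+1
    ... | inj₁ (a+1≤m , pa+1) = subst₂ Adj (sym (snoc-< (≤-pred a+1≤m+1))) (sym pa+1) (step a a+1≤m)
    ... | inj₂ (refl , pa+1)  = subst₂ Adj (sym (snoc-< (≤-pred a+1≤m+1))) (sym pa+1) pm-v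

  segment-cycle : ∀ {m p} a d → Path m p → a + d < m → 2 ≤ d → Adj (p a) (p (a + d))
                → Cycle (suc d) (λ t → p (a + t))
  segment-cycle {m} {p} a d P a+d<m 2≤d pa-pa+d = record
    { path     = Path-drop a (Path-take P (subst (_≤ m) (sym (+-suc a d)) a+d<m))
    ; 3≤length = s≤s 2≤d
    ; closing  = subst (λ i → Adj (p i) (p (a + d))) (sym (+-identityʳ a)) pa-pa+d
    }

  Cycle-edge : ∀ {k g a b} → Cycle k g → a < k → b < k → CycleEdge k a b → Adj (g a) (g b)
  Cycle-edge c _   a+1<k (next a) = Cycle.step c a a+1<k
  Cycle-edge c a+1<k _   (prev a) = Adj-sym (Cycle.step c a a+1<k)
  Cycle-edge c _   _   wrap       = Cycle.closing c
  Cycle-edge c _   _   wrap⁻      = Adj-sym (Cycle.closing c)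

  Cycle-closing : ∀ {k g i} → Cycle k g → i ≡ k ∸ 1 → Adj (g 0) (g i)
  Cycle-closing c refl = Cycle.closing c

  Chordless : ℕ → (ℕ → Fin n) → Set
  Chordless k g = ∀ a b → a < k → b < k → Adj (g a) (g b) → CycleEdge k a b

  CycleEdge? : ∀ k a b → Dec (CycleEdge k a b)
  CycleEdge? k a b with cycAdj k a b in eq
  ... | true  = yes (cycAdj⇒CycleEdge k a b eq)
  ... | false = no λ e → true≢false (trans (sym (CycleEdge⇒cycAdj e)) eq)

  chord-or-chordless : ∀ k g → (∃₂ λ a b → a < k × b < k × Adj (g a) (g b) × ¬ CycleEdge k a b)
                             ⊎ Chordless k g
  chord-or-chordless k g with anyUpTo? (λ a → anyUpTo? (λ b → Adj? (g a) (g b) ×-dec ¬? (CycleEdge? k a b)) k) k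
  ... | yes (a , a<k , b , b<k , ab , ¬e) = inj₁ (a , b , a<k , b<k , ab , ¬e)
  ... | no no-chord = inj₂ chordless
    where
    chordless : Chordless k g
    chordless a b a<k b<k ab with CycleEdge? k a b
    ... | yes e  = e
    ... | no ¬e  = ⊥-elim (no-chord (a , a<k , b , b<k , ab , ¬e))

  chordless-adj : ∀ {k g} → Cycle k g → Chordless k g → ∀ a b → a < k → b < k → adj G (g a) (g b) ≡ cycAdj k a b
  chordless-adj {k} c chordless a b a<k b<k with cycAdj k a b in eq
  ... | true  = Cycle-edge c a<k b<k (cycAdj⇒CycleEdge k a b eq)
  ... | false = ¬Adj⇒adj≡false λ ab → true≢false (trans (sym (CycleEdge⇒cycAdj (chordless a b a<k b<k ab))) eq)

  CycleShorterThan : ℕ → Set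
  CycleShorterThan k = ∃ λ j → j < k × ∃ (Cycle j)

  forward-chord⇒shorter-cycle : ∀ {k g a b} → Cycle k g → a < b → b < k → Adj (g a) (g b) → ¬ CycleEdge k a b
                              → CycleShorterThan k
  forward-chord⇒shorter-cycle {a = a} c a<b b<k ab ¬e with m≤n⇒∃[o]m+o≡n (<⇒≤ a<b)
  ... | d , refl = suc d , chord-length a d b<k ¬e , _ , segment-cycle a d (Cycle.path c) b<k (chord-gap a d a<b ¬e) ab

  chord⇒shorter-cycle : ∀ {k g a b} → Cycle k g → a < k → b < k → Adj (g a) (g b) → ¬ CycleEdge k a b
                      → CycleShorterThan k
  chord⇒shorter-cycle {a = a} {b} c a<k b<k ab ¬e with <-cmp a b
  ... | tri< a<b _ _  = forward-chord⇒shorter-cycle c a<b b<k ab ¬e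
  ... | tri≈ _ refl _ = ⊥-elim (Adj-irrefl ab)
  ... | tri> _ _ b<a  = forward-chord⇒shorter-cycle c b<a a<k (Adj-sym ab) (¬e ∘ CycleEdge-sym)

  rotate-once : ℕ → (ℕ → Fin n) → ℕ → Fin n
  rotate-once k g = snoc (pred k) (λ t → g (suc t)) (g 0)

  Cycle-rotate-once : ∀ {k g} → Cycle k g → Cycle k (rotate-once k g)
  Cycle-rotate-once {zero}        c with () ← Cycle.3≤length c
  Cycle-rotate-once {suc zero}    c with s≤s () ← Cycle.3≤length c
  Cycle-rotate-once {suc (suc j)} {g} c = record
    { path     = Path-snoc (Path-drop 1 path) (Adj-sym closing) g0-new
    ; 3≤length = 3≤length
    ; closing  = subst₂ Adj (sym (snoc-< (s≤s z≤n))) (sym snoc-last) (Adj-sym (step 0 (s≤s (s≤s z≤n))))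
    }
    where
    open Cycle c
    g0-new : ¬ Occurs (suc j) (λ t → g (suc t)) (g 0)
    g0-new (t , t<j+1 , eq) with () ← distinct (suc t) 0 (s≤s t<j+1) (s≤s z≤n) eq

  rotate : ℕ → ℕ → (ℕ → Fin n) → ℕ → Fin n
  rotate k zero    g = g
  rotate k (suc i) g = rotate k i (rotate-once k g)

  Cycle-rotate : ∀ {k g} i → Cycle k g → Cycle k (rotate k i g)
  Cycle-rotate zero    c = c
  Cycle-rotate (suc i) c = Cycle-rotate i (Cycle-rotate-once c)

  rotate-start : ∀ {k g} i → i < k → rotate k i g 0 ≡ g i
  rotate-start zero    _     = refl
  rotate-start (suc i) i+1<k = trans (rotate-start i (<-trans (n<1+n i) i+1<k)) (snoc-< (<⇒≤pred i+1<k))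

  rotate-once-occurs : ∀ {k g v} → Occurs k (rotate-once k g) v → Occurs k g v
  rotate-once-occurs {suc k} (t , t<k+1 , eq) with snoc-cases t<k+1
  ... | inj₁ (t<k , rt) = suc t , s≤s t<k , trans (sym rt) eq
  ... | inj₂ (_ , rt)   = 0 , s≤s z≤n , trans (sym rt) eq

  rotate-occurs : ∀ {k g v} i → Occurs k (rotate k i g) v → Occurs k g v
  rotate-occurs zero    o = o
  rotate-occurs (suc i) o = rotate-once-occurs (rotate-occurs i o)

  detour-cycle : ∀ {k g v b} → Cycle k g → ¬ Occurs k g v → 0 < b → b < k → Adj v (g 0) → Adj v (g b)
               → Cycle (suc (suc b)) (snoc (suc b) g v)
  detour-cycle {k} {g} {v} {b} c v-new 0<b b<k v-g0 v-gb =
    segment-cycle 0 (suc b) (Path-snoc (Path-take (Cycle.path c) b<k) (Adj-sym v-gb) (v-new ∘ widen))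
                  ≤-refl (s≤s 0<b) (subst₂ Adj (sym (snoc-< (s≤s z≤n))) (sym snoc-last) (Adj-sym v-g0))
    where
    widen : Occurs (suc b) g v → Occurs k g v
    widen (t , t≤b , eq) = t , ≤-trans t≤b b<k , eq

  Path-length≤ : ∀ {m p} → Path m p → m ≤ n
  Path-length≤ {m} {p} P = Fin.injective⇒≤ {f = λ (i : Fin m) → p (toℕ i)}
    λ {i} {j} eq → Fin.toℕ-injective (Path.distinct P _ _ (Fin.toℕ<n i) (Fin.toℕ<n j) eq)

  Degree≥2 : Fin n → Set
  Degree≥2 v = ∃₂ λ x y → x ≢ y × Adj v x × Adj v y

  Degree≥2? : ∀ v → Dec (Degree≥2 v)
  Degree≥2? v = Fin.any? λ x → Fin.any? λ y → ¬? (x Fin.≟ y) ×-dec Adj? v x ×-dec Adj? v y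

  Cycle⇒degree≥2 : ∀ {k g a} → Cycle k g → a < k → Degree≥2 (g a)
  Cycle⇒degree≥2 {k} {g} {zero} c 0<k =
    g 1 , g (k ∸ 1) , (1≢k-1 ∘ distinct 1 (k ∸ 1) 1<k (k∸1<k 0<k)) , step 0 1<k , closing
    where
    open Cycle c
    1<k : 1 < k
    1<k = ≤-trans (s≤s (s≤s z≤n)) 3≤length
    1≢k-1 : 1 ≢ k ∸ 1
    1≢k-1 = <⇒≢ (∸-monoˡ-≤ 1 3≤length)
  Cycle⇒degree≥2 {k} {g} {suc a} c a+1<k with suc (suc a) <? k
  ... | yes a+2<k = g a , g (suc (suc a)) , (<⇒≢ (m<n⇒m<1+n (n<1+n a)) ∘ distinct a (suc (suc a)) a<k a+2<k)
                  , Adj-sym (step a a+1<k) , step (suc a) a+2<k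
    where
    open Cycle c
    a<k = <-trans (n<1+n a) a+1<k
  ... | no a+2≮k = g a , g 0 , (a≢0 ∘ distinct a 0 a<k 0<k)
                 , Adj-sym (step a a+1<k) , Adj-sym (Cycle-closing c (last-index a+1<k a+2≮k))
    where
    open Cycle c
    a<k = <-trans (n<1+n a) a+1<k
    0<k = ≤-trans (s≤s z≤n) a<k
    a≢0 : a ≢ 0
    a≢0 refl = <⇒≢ (∸-monoˡ-≤ 1 3≤length) (last-index a+1<k a+2≮k)

  MaximalPath : Set
  MaximalPath = ∃₂ λ m p → Path (suc m) p × (∀ w → Adj (p m) w → Occurs (suc m) p w)

  extend-to-maximal-path : ∀ fuel {m p} → n ≤ m + fuel → Path (suc m) p → MaximalPath
  extend-to-maximal-path zero {m} n≤m+0 P =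
    ⊥-elim (n≮n m (≤-trans (Path-length≤ P) (subst (n ≤_) (+-identityʳ m) n≤m+0)))
  extend-to-maximal-path (suc fuel) {m} {p} n≤m+fuel+1 P
    with Fin.any? (λ w → Adj? (p m) w ×-dec ¬? (Occurs? (suc m) p w))
  ... | yes (w , pm-w , w-new) =
        extend-to-maximal-path fuel (subst (n ≤_) (+-suc m fuel) n≤m+fuel+1) (Path-snoc P pm-w w-new)
  ... | no ¬extendable = m , p , P , maximal
    where
    maximal : ∀ w → Adj (p m) w → Occurs (suc m) p w
    maximal w pm-w with Occurs? (suc m) p w
    ... | yes occurs = occurs
    ... | no w-new   = ⊥-elim (¬extendable (w , pm-w , w-new))

  trivial-path : ∀ v → Path 1 (λ _ → v)
  trivial-path v = record { distinct = λ { _ _ (s≤s z≤n) (s≤s z≤n) _ → refl } ; step = λ { _ (s≤s ()) } }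

  back-edge⇒cycle : ∀ {m p c} → Path (suc m) p → c < suc m → c ≢ m ∸ 1 → Adj (p m) (p c) → ∃₂ Cycle
  back-edge⇒cycle {p = p} {c} P c≤m c≢m-1 pm-pc with m≤n⇒∃[o]m+o≡n (≤-pred c≤m)
  ... | d , refl = suc d , _ , segment-cycle c d P ≤-refl (back-edge-gap c d (Adj⇒≢ pm-pc ∘ cong p) c≢m-1) (Adj-sym pm-pc)

  maximal-path⇒cycle : (∀ v → Degree≥2 v) → MaximalPath → ∃₂ Cycle
  maximal-path⇒cycle degree≥2 (m , p , P , maximal) with degree≥2 (p m)
  ... | x , y , x≢y , pm-x , pm-y with maximal x pm-x | maximal y pm-y
  ... | i , i≤m , refl | j , j≤m , refl with i ≟ m ∸ 1
  ... | no i≢m-1    = back-edge⇒cycle P i≤m i≢m-1 pm-x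
  ... | yes i≡m-1   = back-edge⇒cycle P j≤m (λ j≡m-1 → x≢y (cong p (trans i≡m-1 (sym j≡m-1)))) pm-y

  Cycle-of-embedding : ∀ {k} .{{_ : NonZero k}} (f : Fin k → Fin n) → 3 ≤ k → Injective _≡_ _≡_ f
                     → (∀ i j → cycAdj k (toℕ i) (toℕ j) ≡ true → Adj (f i) (f j))
                     → Cycle k (λ a → f (a mod k))
  Cycle-of-embedding {k} f 3≤k f-injective f-edges = record
    { path     = record { distinct = distinct ; step = λ a a+1<k → edge (<-trans (n<1+n a) a+1<k) a+1<k (next a) }
    ; 3≤length = 3≤k
    ; closing  = edge (≤-trans (s≤s z≤n) 3≤k) (k∸1<k (≤-trans (s≤s z≤n) 3≤k)) wrap
    }
    where
    edge : ∀ {a b} → a < k → b < k → CycleEdge k a b → Adj (f (a mod k)) (f (b mod k))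
    edge a<k b<k e = f-edges _ _ (CycleEdge⇒cycAdj (subst₂ (CycleEdge k) (sym (toℕ-mod a<k)) (sym (toℕ-mod b<k)) e))
    distinct : ∀ a b → a < k → b < k → f (a mod k) ≡ f (b mod k) → a ≡ b
    distinct a b a<k b<k eq = trans (sym (toℕ-mod a<k)) (trans (cong toℕ (f-injective eq)) (toℕ-mod b<k))

  spanning⇒n≤length : ∀ {k g} → (∀ v → Occurs k g v) → n ≤ k
  spanning⇒n≤length {k} {g} spanning = Fin.injective⇒≤ {f = index} index-injective
    where
    index : Fin n → Fin k
    index v = fromℕ< (proj₁ (proj₂ (spanning v)))
    index-correct : ∀ v → g (toℕ (index v)) ≡ v
    index-correct v = let _ , a<k , ga≡v = spanning v in trans (cong g (Fin.toℕ-fromℕ< a<k)) ga≡v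
    index-injective : Injective _≡_ _≡_ index
    index-injective {u} {v} eq = trans (sym (index-correct u)) (trans (cong (g ∘ toℕ) eq) (index-correct v))

  spanning-chordless-cycle⇒IsLongCycle : ∀ {k g} → Cycle k g → Chordless k g → (∀ v → Occurs k g v) → 4 ≤ k
                                        → IsLongCycle G
  spanning-chordless-cycle⇒IsLongCycle {k} {g} c chordless spanning 4≤k
    with ≤-antisym (Path-length≤ (Cycle.path c)) (spanning⇒n≤length spanning)
  ... | refl = 4≤k , f , (f-injective , f-surjective) , λ i j → chordless-adj c chordless _ _ (Fin.toℕ<n i) (Fin.toℕ<n j)
    where
    f : Fin k → Fin k
    f i = g (toℕ i)
    f-injective : Injective _≡_ _≡_ f
    f-injective {i} {j} eq = Fin.toℕ-injective (Cycle.distinct c _ _ (Fin.toℕ<n i) (Fin.toℕ<n j) eq)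
    f-surjective : Surjective _≡_ _≡_ f
    f-surjective v = let a , a<k , ga≡v = spanning v in
                     fromℕ< a<k , λ { refl → trans (cong g (Fin.toℕ-fromℕ< a<k)) ga≡v }

  -- Graphs without triangles and 4-cycles
  record SpanningInducedCycle : Set where
    field
      {length}  : ℕ
      {vertex}  : ℕ → Fin n
      cycle     : Cycle length vertex
      chordless : Chordless length vertex
      spanning  : ∀ v → Occurs length vertex v

  module _ (connected : Connected G) (pan-free : ¬ HasInducedPan G)
           (triangle-free : ∀ {a b c} → ¬ Triangle a b c) (square-free : ∀ {a b c d} → ¬ Square a b c d) where

    two-neighbours⇒shorter-cycle : ∀ {k g v b} → Cycle k g → ¬ Occurs k g v → 0 < b → b < k
                                 → Adj v (g 0) → Adj v (g b) → CycleShorterThan k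
    -- The detour g 0, …, g b, v is shorter unless b is k-1 or k-2, where v closes a triangle or a 4-cycle.
    two-neighbours⇒shorter-cycle {k} {g} {v} {b} c v-new 0<b b<k v-g0 v-gb with suc (suc b) <? k
    ... | yes b+2<k = suc (suc b) , b+2<k , _ , detour-cycle c v-new 0<b b<k v-g0 v-gb
    ... | no b+2≮k with suc b <? k
    ...   | no b+1≮k  = ⊥-elim (triangle-free (v-g0 , Cycle-closing c (last-index b<k b+1≮k) , v-gb))
    ...   | yes b+1<k = ⊥-elim (square-free
                          (v-g0 , Cycle-closing c (last-index b+1<k b+2≮k) , Adj-sym (Cycle.step c b b+1<k) , Adj-sym v-gb
                          , (λ v≡ → v-new (suc b , b+1<k , sym v≡))
                          , (λ g0≡gb → <⇒≢ 0<b (Cycle.distinct c 0 b (≤-trans (s≤s z≤n) b<k) b<k g0≡gb))))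

    attached-vertex⇒shorter-cycle : ∀ {k g v} → Cycle k g → ¬ Occurs k g v → Adj v (g 0) → CycleShorterThan k
    attached-vertex⇒shorter-cycle {k} {g} {v} c v-new v-g0 with chord-or-chordless k g
    ... | inj₁ (a , b , a<k , b<k , ab , ¬e) = chord⇒shorter-cycle c a<k b<k ab ¬e
    ... | inj₂ chordless with anyUpTo? (λ b → (0 <? b) ×-dec Adj? v (g b)) k
    ...   | yes (b , b<k , 0<b , v-gb) = two-neighbours⇒shorter-cycle c v-new 0<b b<k v-g0 v-gb
    ...   | no ¬other = ⊥-elim (pan-free (induced-pan k (Cycle.3≤length c) g (Cycle.distinct c)
                          (chordless-adj c chordless) v (λ a a<k ga≡v → v-new (a , a<k , ga≡v)) v-g0
                          λ b 0<b b<k v-gb → ¬other (b , b<k , 0<b , v-gb)))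

    not-spanning⇒attached-vertex : ∀ {k g} → Cycle k g → ¬ (∀ v → Occurs k g v)
                                 → ∃₂ λ i v → i < k × ¬ Occurs k g v × Adj v (g i)
    not-spanning⇒attached-vertex {k} {g} c ¬spanning
      with Fin.¬∀⟶∃¬ n _ (Occurs? k g) ¬spanning
    ... | u , u-off with Star-exit (Occurs? k g) (connected (g 0) u) (0 , ≤-trans (s≤s z≤n) (Cycle.3≤length c) , refl) u-off
    ... | _ , v , (i , i<k , refl) , v-off , gi-v = i , v , i<k , v-off , Adj-sym gi-v

    cycle-step : ∀ {k g} → Cycle k g → SpanningInducedCycle ⊎ CycleShorterThan k
    cycle-step {k} {g} c with Fin.all? (Occurs? k g)
    ... | no ¬spanning =
          let i , v , i<k , v-off , v-gi = not-spanning⇒attached-vertex c ¬spanning in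
          -- rotate so that v is attached at index 0, where a pan has its handle
          inj₂ (attached-vertex⇒shorter-cycle (Cycle-rotate i c) (v-off ∘ rotate-occurs i)
                  (subst (Adj v) (sym (rotate-start i i<k)) v-gi))
    ... | yes spanning with chord-or-chordless k g
    ...   | inj₁ (a , b , a<k , b<k , ab , ¬e) = inj₂ (chord⇒shorter-cycle c a<k b<k ab ¬e)
    ...   | inj₂ chordless = inj₁ (record { cycle = c ; chordless = chordless ; spanning = spanning })

    spanning-induced-cycle : ∀ k {g} → Cycle k g → SpanningInducedCycle
    spanning-induced-cycle = <-rec (λ k → ∀ {g} → Cycle k g → SpanningInducedCycle) step
      where
      step : ∀ k → (∀ {j} → j < k → ∀ {g} → Cycle j g → SpanningInducedCycle) → ∀ {g} → Cycle k g → SpanningInducedCycle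
      step k shorter c with cycle-step c
      ... | inj₁ s                  = s
      ... | inj₂ (j , j<k , _ , c′) = shorter j<k c′

    triangle-free⇒4≤length : ∀ {k g} → Cycle k g → 4 ≤ k
    triangle-free⇒4≤length c = ≤∧≢⇒< 3≤length λ { refl → triangle-free (step 0 (s≤s (s≤s z≤n)) , step 1 ≤-refl , closing) }
      where open Cycle c

    cycle⇒degree≥2 : ∀ {k g} → Cycle k g → ∀ v → Degree≥2 v
    cycle⇒degree≥2 c v with spanning-induced-cycle _ c
    ... | record { cycle = c′ ; spanning = spanning } with spanning v
    ... | _ , a<k , refl = Cycle⇒degree≥2 c′ a<k

    low-degree⇒acyclic : ∀ {v} → ¬ Degree≥2 v → Acyclic G
    low-degree⇒acyclic ¬deg (zero  , ()  , _)
    low-degree⇒acyclic ¬deg (suc k , 3≤k , f , f-injective , f-edges) =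
      ¬deg (cycle⇒degree≥2 (Cycle-of-embedding f 3≤k f-injective f-edges) _)

    degree≥2⇒long-cycle : (∀ v → Degree≥2 v) → Fin n → IsLongCycle G
    degree≥2⇒long-cycle degree≥2 v
      with maximal-path⇒cycle degree≥2 (extend-to-maximal-path n ≤-refl (trivial-path v))
    ... | k , _ , c with spanning-induced-cycle k c
    ... | record { cycle = c′ ; chordless = chordless ; spanning = spanning } =
          spanning-chordless-cycle⇒IsLongCycle c′ chordless spanning (triangle-free⇒4≤length c′)

acyclic-or-long-cycle : ∀ {n} (G : Graph n) → Connected G → ¬ HasInducedPan G
                      → (∀ {a b c} → ¬ Triangle G a b c) → (∀ {a b c d} → ¬ Square G a b c d)
                      → Acyclic G ⊎ IsLongCycle G
acyclic-or-long-cycle {zero} G _ _ _ _ = inj₁ λ { (zero , () , _) ; (suc _ , _ , f , _) → Fin.¬Fin0 (f fzero) }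
acyclic-or-long-cycle {suc n} G connected pan-free triangle-free square-free with Fin.all? (Degree≥2? G)
... | yes degree≥2 = inj₂ (degree≥2⇒long-cycle G connected pan-free triangle-free square-free degree≥2 fzero)
... | no ¬degree≥2 =
      let _ , low = Fin.¬∀⟶∃¬ (suc n) _ (Degree≥2? G) ¬degree≥2 in
      inj₁ (low-degree⇒acyclic G connected pan-free triangle-free square-free low)

triangle? : ∀ {n} (G : Graph n) → Dec (∃₂ λ a b → ∃ (Triangle G a b))
triangle? G = Fin.any? λ a → Fin.any? λ b → Fin.any? λ c → Adj? G a b ×-dec Adj? G b c ×-dec Adj? G a c

square? : ∀ {n} (G : Graph n) → Dec (∃₂ λ a b → ∃₂ (Square G a b))
square? G = Fin.any? λ a → Fin.any? λ b → Fin.any? λ c → Fin.any? λ d →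
  Adj? G a b ×-dec Adj? G b c ×-dec Adj? G c d ×-dec Adj? G d a ×-dec ¬? (a Fin.≟ c) ×-dec ¬? (b Fin.≟ d)

lemma3 : ∀ {n : ℕ} (G : Graph n) → Connected G
           → ¬ HasInducedDiamond G → ¬ HasInducedPan G
           → Acyclic G ⊎ IsLongCycle G ⊎ IsComplete G ⊎ IsCompleteBipartite G
lemma3 G connected diamond-free pan-free with triangle? G
... | yes (_ , _ , _ , t) = inj₂ (inj₂ (inj₁ (triangle⇒complete G diamond-free pan-free connected t)))
... | no no-triangle with square? G
...   | yes (_ , _ , _ , _ , sq) =
        inj₂ (inj₂ (inj₂ (square⇒complete-bipartite G pan-free (λ t → no-triangle (_ , _ , _ , t)) connected sq)))
...   | no no-square =
        map₂ inj₁ (acyclic-or-long-cycle G connected pan-free (λ t → no-triangle (_ , _ , _ , t))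
                                                               (λ sq → no-square (_ , _ , _ , _ , sq)))
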